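{- (1) If $L$ is a regular language over a finite totally ordered alphabet, then the language $\mathrm{Max}(L)$ is regular. (2) If $U$ is a positional numeration system such that $\mathrm{Max}(L_U)$ is regular, then the numeration language $L_U$ is also regular.
   Context: A positional numeration system is an increasing sequence $U=(U_n)_{n\ge0}$ of integers with $U_0=1$ and $\sup_n U_{n+1}/U_n<\infty$. The greedy representation of $x\in\mathbb N$: let $\ell$ be least with $x<U_\ell$, set $r_\ell=x$ and for $n=\ell-1,\dots,0$ put $a_n=\lfloor r_{n+1}/U_n\rfloor$, $r_n=r_{n+1}-a_nU_n$; then $\mathrm{rep}_U(x)=a_{\ell-1}\cdots a_0$. The numeration alphabet is $A_U=\{0,\dots,\sup_{n}\lceil U_{n+1}/U_n\rceil-1\}$ (ordered naturally) and the numeration language is $L_U=0^*\mathrm{rep}_U(\mathbb N)$. For a language $L$ over a totally ordered alphabet, $\mathrm{Max}(L)=\{u\in L:\forall v\in L,\ |v|=|u|\Rightarrow v\le_{\mathrm{lex}}u\}$, where $\le_{\mathrm{lex}}$ is the lexicographic order. -}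

module Defs where

open import Data.Nat using (ℕ; zero; suc; _+_; _*_; _∸_; _≤_; _<_; z≤n; s≤s; NonZero; >-nonZero)
open import Data.Nat.DivMod using (_/_; _%_)
open import Data.Nat.Properties using (≤-trans)
open import Data.Fin as F using (Fin; toℕ)
open import Data.Bool using (Bool; true)
open import Data.List using (List; []; _∷_; foldl; length; map; replicate; _++_)
open import Data.Product using (Σ; ∃; _×_; _,_)
open import Function.Bundles using (_⇔_)
open import Relation.Binary.PropositionalEquality using (_≡_; subst; sym)

-- Languages over the finite totally ordered alphabet Fin k
-- (any finite totally ordered alphabet is order-isomorphic to some Fin k,
--  ordered naturally).

Lang : ℕ → Set₁
Lang k = List (Fin k) → Set

record DFA (k : ℕ) : Set where
  field
    nstates : ℕ
    start   : Fin nstates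
    δ       : Fin nstates → Fin k → Fin nstates
    final   : Fin nstates → Bool

Accepts : ∀ {k} → DFA k → List (Fin k) → Set
Accepts D w = final (foldl δ start w) ≡ true
  where open DFA D

Regular : ∀ {k} → Lang k → Set
Regular {k} L = Σ (DFA k) λ D → ∀ w → (L w ⇔ Accepts D w)

data _≤lex_ {k : ℕ} : List (Fin k) → List (Fin k) → Set where
  []≤   : ∀ {v} → [] ≤lex v
  head< : ∀ {a b u v} → a F.< b → (a ∷ u) ≤lex (b ∷ v)
  head≡ : ∀ {a u v} → u ≤lex v → (a ∷ u) ≤lex (a ∷ v)

Max : ∀ {k} → Lang k → Lang k
Max L u = L u × (∀ v → L v → length v ≡ length u → v ≤lex u)

-- Positional numeration systems.
-- sup_n U(n+1)/U(n) < ∞  is rendered as: ∃ C ∈ ℕ, ∀ n, U(n+1) ≤ C·U(n).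

record NumSys : Set where
  field
    U     : ℕ → ℕ
    U0    : U 0 ≡ 1
    incr  : ∀ n → U n < U (suc n)
    bound : ∃ λ C → ∀ n → U (suc n) ≤ C * U n

U-nonZero : (S : NumSys) → ∀ n → NonZero (NumSys.U S n)
U-nonZero S zero    = subst NonZero (sym (NumSys.U0 S)) _
U-nonZero S (suc n) = >-nonZero (≤-trans (s≤s z≤n) (NumSys.incr S n))

⌈_/_⌉ : ℕ → (b : ℕ) → .{{NonZero b}} → ℕ
⌈ a / b ⌉ = (a + b ∸ 1) / b

greedy : (S : NumSys) → ℕ → ℕ → List ℕ
greedy S zero    r = []
greedy S (suc n) r =
  (r / NumSys.U S n) {{U-nonZero S n}} ∷ greedy S n ((r % NumSys.U S n) {{U-nonZero S n}})

Rep : NumSys → ℕ → List ℕ → Set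
Rep S x w = ∃ λ ℓ → x < NumSys.U S ℓ
                  × (∀ m → x < NumSys.U S m → ℓ ≤ m)
                  × w ≡ greedy S ℓ x

-- k is the size of the numeration alphabet A_U = {0,…,k-1}, i.e.
-- k = sup_n ⌈U(n+1)/U(n)⌉ (a bounded set of naturals, so the sup is attained).
IsAlphSize : NumSys → ℕ → Set
IsAlphSize S k =
  (∀ n → ⌈ U (suc n) / U n ⌉ {{U-nonZero S n}} ≤ k)
  × (∃ λ n → ⌈ U (suc n) / U n ⌉ {{U-nonZero S n}} ≡ k)
  where open NumSys S

LU : NumSys → (k : ℕ) → Lang k
LU S k w = ∃ λ m → ∃ λ x → ∃ λ v → Rep S x v × map toℕ w ≡ replicate m 0 ++ v

{-# OPTIONS --safe #-}
-- Max L is L minus the words u for which L has a lexicographically larger word v of the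
-- same length. A nondeterministic automaton recognises those u by guessing v letter by
-- letter while running a DFA for L on it; so Max L is regular by the subset construction
-- and closure under complement and intersection.
--
-- A word over A_U lies in L_U exactly when all its suffixes s are admissible,
-- val s < U |s|. The greedy representation of U n − 1 is the maximal word of L_U of
-- length n, and for words of equal length whose tails are admissible, u <lex v implies
-- val u < val v. Hence w ∈ L_U iff no suffix of w lies lexicographically above the word of
-- Max L_U of its length: L_U is the complement of Σ* · {s above some m ∈ Max L_U with
-- |m| = |s|}, which is regular by the same construction as above.
module Submission where

open import Defs
open import Data.Bool as Bool using (Bool; true; false; not; _∧_)
open import Data.Empty using (⊥)
open import Data.Fin as F using (Fin; toℕ)
open import Data.Fin.Properties using (any?; remQuot-combine; finToFun-funToFin; 2↔Bool; *↔×; toℕ-fromℕ<)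
import Data.Fin.Properties as FP
open import Data.List using (List; []; _∷_; foldl; length; map; replicate; drop; _++_)
open import Data.List.Properties using (length-map; map-++; ∷-injectiveʳ)
open import Data.List.Relation.Binary.Lex.Core using (base; halt; this; next)
open import Data.List.Relation.Binary.Lex.Strict using (Lex-<)
open import Data.List.Relation.Unary.All using (All; []; _∷_)
open import Data.Nat
  using (ℕ; zero; suc; _+_; _*_; _∸_; _^_; _≤_; _<_; pred; z≤n; s≤s⁻¹; NonZero; >-nonZero⁻¹)
open import Data.Nat.DivMod
open import Data.Nat.Divisibility using (n∣m*n)
open import Data.Nat.Properties
open import Data.Product using (∃; ∃₂; _×_; _,_; proj₂)
open import Data.Product.Function.NonDependent.Propositional using (_×-↔_; _×-⇔_)
open import Data.Sum using (_⊎_; inj₁; inj₂; [_,_])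
import Data.Sum as Sum
open import Data.Unit using (⊤; tt)
open import Function using (_∘_; flip; id; _⇔_; mk⇔; _↠_; Inverse; Surjection; Equivalence)
open import Function.Properties.Inverse using (↔-refl; ↔-trans; ↔⇒↠)
import Function.Properties.Equivalence as ⇔
open import Relation.Binary using (tri<; tri≈; tri>)
open import Relation.Binary.PropositionalEquality
  using (_≡_; refl; sym; trans; cong; cong₂; subst; subst₂; module ≡-Reasoning)
open import Relation.Nullary using (¬_; Dec; yes; no; does; contradiction)
open import Relation.Nullary.Decidable using (_×-dec_)
open import Relation.Unary using (∁; _∩_)

open Equivalence using (to; from)

does≡true⇔ : ∀ {P : Set} (P? : Dec P) → does P? ≡ true ⇔ P
does≡true⇔ (yes p) = mk⇔ (λ _ → p) (λ _ → refl)
does≡true⇔ (no ¬p) = mk⇔ (λ ()) (λ p → contradiction p ¬p)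

not≡true⇔ : ∀ {b} → not b ≡ true ⇔ (¬ b ≡ true)
not≡true⇔ {false} = mk⇔ (λ _ ()) (λ _ → refl)
not≡true⇔ {true}  = mk⇔ (λ ()) (λ ¬t → contradiction refl ¬t)

∧≡true⇔ : ∀ {b c} → b ∧ c ≡ true ⇔ (b ≡ true × c ≡ true)
∧≡true⇔ {true}  = mk⇔ (refl ,_) proj₂
∧≡true⇔ {false} = mk⇔ (λ ()) (λ { (() , _) })

¬-cong-⇔ : ∀ {A B : Set} → A ⇔ B → (¬ A) ⇔ (¬ B)
¬-cong-⇔ A⇔B = mk⇔ (λ ¬a b → ¬a (from A⇔B b)) (λ ¬b a → ¬b (to A⇔B a))

-- Closure properties of regular languages

DAcceptsFrom : ∀ {k} (D : DFA k) → Fin (DFA.nstates D) → Lang k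
DAcceptsFrom D q w = DFA.final D (foldl (DFA.δ D) q w) ≡ true

Regular-resp : ∀ {k} {L M : Lang k} → (∀ w → L w ⇔ M w) → Regular L → Regular M
Regular-resp L⇔M (D , L⇔D) = D , λ w → ⇔.trans (⇔.sym (L⇔M w)) (L⇔D w)

Regular-∁ : ∀ {k} {L : Lang k} → Regular L → Regular (∁ L)
Regular-∁ (D , L⇔D) = record D { final = not ∘ DFA.final D }
                    , λ w → ⇔.trans (¬-cong-⇔ (L⇔D w)) (⇔.sym not≡true⇔)

module _ {k : ℕ} (D E : DFA k) where
  private
    module D = DFA D
    module E = DFA E

    pairStep : Fin D.nstates × Fin E.nstates → Fin k → Fin (D.nstates * E.nstates)
    pairStep (p , q) a = F.combine (D.δ p a) (E.δ q a)

    pairFinal : Fin D.nstates × Fin E.nstates → Bool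
    pairFinal (p , q) = D.final p ∧ E.final q

  ×-DFA : DFA k
  ×-DFA = record
    { nstates = D.nstates * E.nstates
    ; start   = F.combine D.start E.start
    ; δ       = pairStep ∘ F.remQuot E.nstates
    ; final   = pairFinal ∘ F.remQuot E.nstates
    }

  ×-DFA-run : ∀ p q w →
    foldl (DFA.δ ×-DFA) (F.combine p q) w ≡ F.combine (foldl D.δ p w) (foldl E.δ q w)
  ×-DFA-run p q []      = refl
  ×-DFA-run p q (a ∷ w) = trans
    (cong (λ pq → foldl (DFA.δ ×-DFA) (pairStep pq a) w) (remQuot-combine p q))
    (×-DFA-run (D.δ p a) (E.δ q a) w)

  ×-DFA-final-run : ∀ w → DFA.final ×-DFA (foldl (DFA.δ ×-DFA) (DFA.start ×-DFA) w)
                         ≡ D.final (foldl D.δ D.start w) ∧ E.final (foldl E.δ E.start w)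
  ×-DFA-final-run w = begin
    pairFinal (F.remQuot E.nstates (foldl (DFA.δ ×-DFA) (F.combine D.start E.start) w))
      ≡⟨ cong (pairFinal ∘ F.remQuot E.nstates) (×-DFA-run D.start E.start w) ⟩
    pairFinal (F.remQuot E.nstates (F.combine (foldl D.δ D.start w) (foldl E.δ E.start w)))
      ≡⟨ cong pairFinal (remQuot-combine (foldl D.δ D.start w) (foldl E.δ E.start w)) ⟩
    D.final (foldl D.δ D.start w) ∧ E.final (foldl E.δ E.start w) ∎
    where open ≡-Reasoning

  ×-DFA-accepts : ∀ w → Accepts ×-DFA w ⇔ (Accepts D w × Accepts E w)
  ×-DFA-accepts w = subst (λ b → b ≡ true ⇔ (Accepts D w × Accepts E w))
                          (sym (×-DFA-final-run w)) ∧≡true⇔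

Regular-∩ : ∀ {k} {L M : Lang k} → Regular L → Regular M → Regular (L ∩ M)
Regular-∩ (D , L⇔D) (E , M⇔E) =
  ×-DFA D E , λ w → ⇔.trans (L⇔D w ×-⇔ M⇔E w) (⇔.sym (×-DFA-accepts D E w))

-- Nondeterministic automata and the subset construction

record NFA (k : ℕ) : Set₁ where
  field
    State       : Set
    size        : ℕ
    enumeration : Fin size ↠ State
    Initial     : State → Set
    Step        : State → Fin k → State → Set
    Final       : State → Set
    initial?    : ∀ q → Dec (Initial q)
    step?       : ∀ q a q′ → Dec (Step q a q′)
    final?      : ∀ q → Dec (Final q)

module _ {k : ℕ} (N : NFA k) where
  open NFA N

  NAcceptsFrom : State → Lang k
  NAcceptsFrom q []      = Final q
  NAcceptsFrom q (a ∷ w) = ∃ λ q′ → Step q a q′ × NAcceptsFrom q′ w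

  NAccepts : Lang k
  NAccepts w = ∃ λ q → Initial q × NAcceptsFrom q w

-- Fin (2 ^ n) codes the subsets of Fin n through their characteristic functions.
fromPred : ∀ {n} {P : Fin n → Set} → (∀ i → Dec (P i)) → Fin (2 ^ n)
fromPred P? = F.funToFin (Inverse.from 2↔Bool ∘ does ∘ P?)

_∈ˢ_ : ∀ {n} → Fin n → Fin (2 ^ n) → Set
i ∈ˢ S = Inverse.to 2↔Bool (F.finToFun S i) ≡ true

_∈ˢ?_ : ∀ {n} (i : Fin n) S → Dec (i ∈ˢ S)
i ∈ˢ? S = Inverse.to 2↔Bool (F.finToFun S i) Bool.≟ true

∈ˢ-fromPred : ∀ {n} {P : Fin n → Set} (P? : ∀ i → Dec (P i)) i → i ∈ˢ fromPred P? ⇔ P i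
∈ˢ-fromPred P? i
  rewrite finToFun-funToFin (Inverse.from 2↔Bool ∘ does ∘ P?) i
        | Inverse.strictlyInverseˡ 2↔Bool (does (P? i)) = does≡true⇔ (P? i)

module Determinisation {k : ℕ} (N : NFA k) where
  open NFA N
  open Surjection enumeration using () renaming (to to state; strictlySurjective to state-surjective)

  successor? : ∀ S a j → Dec (∃ λ i → i ∈ˢ S × Step (state i) a (state j))
  successor? S a j = any? λ i → i ∈ˢ? S ×-dec step? (state i) a (state j)

  δ : Fin (2 ^ size) → Fin k → Fin (2 ^ size)
  δ S a = fromPred (successor? S a)

  final : Fin (2 ^ size) → Bool
  final S = does (any? λ i → i ∈ˢ? S ×-dec final? (state i))

  subsetDFA : DFA k
  subsetDFA = record
    { nstates = 2 ^ size
    ; start   = fromPred (initial? ∘ state)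
    ; δ       = δ
    ; final   = final
    }

  subsetDFA-run : ∀ S w → DAcceptsFrom subsetDFA S w ⇔ ∃ λ i → i ∈ˢ S × NAcceptsFrom N (state i) w
  subsetDFA-run S []      = does≡true⇔ (any? _)
  subsetDFA-run S (a ∷ w) = ⇔.trans (subsetDFA-run (δ S a) w) (mk⇔ forward backward)
    where
    forward : (∃ λ j → j ∈ˢ δ S a × NAcceptsFrom N (state j) w) →
              ∃ λ i → i ∈ˢ S × NAcceptsFrom N (state i) (a ∷ w)
    forward (j , j∈ , acc) with to (∈ˢ-fromPred (successor? S a) j) j∈
    ... | i , i∈ , step = i , i∈ , state j , step , acc
    backward : (∃ λ i → i ∈ˢ S × NAcceptsFrom N (state i) (a ∷ w)) →
               ∃ λ j → j ∈ˢ δ S a × NAcceptsFrom N (state j) w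
    backward (i , i∈ , q′ , step , acc) with state-surjective q′
    ... | j , refl = j , from (∈ˢ-fromPred (successor? S a) j) (i , i∈ , step) , acc

  subsetDFA-accepts : ∀ w → Accepts subsetDFA w ⇔ NAccepts N w
  subsetDFA-accepts w = ⇔.trans (subsetDFA-run (DFA.start subsetDFA) w) (mk⇔ forward backward)
    where
    forward : (∃ λ i → i ∈ˢ DFA.start subsetDFA × NAcceptsFrom N (state i) w) → NAccepts N w
    forward (i , i∈ , acc) = state i , to (∈ˢ-fromPred (initial? ∘ state) i) i∈ , acc
    backward : NAccepts N w → ∃ λ i → i ∈ˢ DFA.start subsetDFA × NAcceptsFrom N (state i) w
    backward (q , init , acc) with state-surjective q
    ... | i , refl = i , from (∈ˢ-fromPred (initial? ∘ state) i) init , acc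

Regular-NAccepts : ∀ {k} (N : NFA k) → Regular (NAccepts N)
Regular-NAccepts N = subsetDFA , λ w → ⇔.sym (subsetDFA-accepts w)
  where open Determinisation N

×Bool-enumeration : ∀ n → Fin (n * 2) ↠ (Fin n × Bool)
×Bool-enumeration n = ↔⇒↠ (↔-trans *↔× (↔-refl ×-↔ 2↔Bool))

Dominated : ∀ {k} → (Fin k → Fin k → Set) → Lang k → Lang k
Dominated R L u = ∃ λ v → L v × length v ≡ length u × Lex-< _≡_ R u v

module DominationNFA {k : ℕ} {R : Fin k → Fin k → Set}
                     (R? : ∀ a b → Dec (R a b)) (D : DFA k) where
  open DFA D

  -- The flag records whether the guessed word has already passed the input,
  -- i.e. whether their first difference has been read.
  Initial : Fin nstates × Bool → Set
  Initial (q , false) = q ≡ start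
  Initial (_ , true)  = ⊥

  Step : Fin nstates × Bool → Fin k → Fin nstates × Bool → Set
  Step (q , false) a (q′ , false) = q′ ≡ δ q a
  Step (q , false) a (q′ , true)  = ∃ λ b → R a b × q′ ≡ δ q b
  Step (_ , true)  _ (_  , false) = ⊥
  Step (q , true)  _ (q′ , true)  = ∃ λ b → q′ ≡ δ q b

  Final : Fin nstates × Bool → Set
  Final (_ , false) = ⊥
  Final (q , true)  = final q ≡ true

  automaton : NFA k
  automaton = record
    { State       = Fin nstates × Bool
    ; size        = nstates * 2
    ; enumeration = ×Bool-enumeration nstates
    ; Initial     = Initial
    ; Step        = Step
    ; Final       = Final
    ; initial?    = λ { (q , false) → q F.≟ start ; (_ , true) → no λ () }
    ; step?       = λ { (q , false) a (q′ , false) → q′ F.≟ δ q a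
                      ; (q , false) a (q′ , true)  → any? λ b → R? a b ×-dec q′ F.≟ δ q b
                      ; (_ , true)  _ (_  , false) → no λ ()
                      ; (q , true)  _ (q′ , true)  → any? λ b → q′ F.≟ δ q b }
    ; final?      = λ { (_ , false) → no λ () ; (q , true) → final q Bool.≟ true }
    }

  passed-spec : ∀ q u → NAcceptsFrom automaton (q , true) u
                      ⇔ ∃ λ v → DAcceptsFrom D q v × length v ≡ length u
  passed-spec q []      = mk⇔ (λ acc → [] , acc , refl)
                              (λ { ([] , acc , _) → acc ; (_ ∷ _ , _ , ()) })
  passed-spec q (a ∷ u) = mk⇔ forward backward
    where
    forward : NAcceptsFrom automaton (q , true) (a ∷ u) →
              ∃ λ v → DAcceptsFrom D q v × length v ≡ length (a ∷ u)
    forward ((_ , true) , (b , refl) , acc) with to (passed-spec (δ q b) u) acc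
    ... | v , accv , len = b ∷ v , accv , cong suc len
    backward : (∃ λ v → DAcceptsFrom D q v × length v ≡ length (a ∷ u)) →
               NAcceptsFrom automaton (q , true) (a ∷ u)
    backward (b ∷ v , accv , len) =
      (δ q b , true) , (b , refl) , from (passed-spec (δ q b) u) (v , accv , suc-injective len)

  level-spec : ∀ q u → NAcceptsFrom automaton (q , false) u
                     ⇔ ∃ λ v → DAcceptsFrom D q v × length v ≡ length u × Lex-< _≡_ R u v
  level-spec q []      = mk⇔ (λ ()) (λ { ([] , _ , _ , base ()) ; (_ ∷ _ , _ , () , _) })
  level-spec q (a ∷ u) = mk⇔ forward backward
    where
    forward : NAcceptsFrom automaton (q , false) (a ∷ u) →
              ∃ λ v → DAcceptsFrom D q v × length v ≡ length (a ∷ u) × Lex-< _≡_ R (a ∷ u) v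
    forward ((_ , false) , refl , acc) with to (level-spec (δ q a) u) acc
    ... | v , accv , len , u<v = a ∷ v , accv , cong suc len , next refl u<v
    forward ((_ , true) , (b , aRb , refl) , acc) with to (passed-spec (δ q b) u) acc
    ... | v , accv , len = b ∷ v , accv , cong suc len , this aRb
    backward : (∃ λ v → DAcceptsFrom D q v × length v ≡ length (a ∷ u) × Lex-< _≡_ R (a ∷ u) v) →
               NAcceptsFrom automaton (q , false) (a ∷ u)
    backward (b ∷ v , accv , len , this aRb) =
      (δ q b , true) , (b , aRb , refl) , from (passed-spec (δ q b) u) (v , accv , suc-injective len)
    backward (_ ∷ v , accv , len , next refl u<v) =
      (δ q a , false) , refl , from (level-spec (δ q a) u) (v , accv , suc-injective len , u<v)

Regular-Dominated : ∀ {k} {R : Fin k → Fin k → Set} {L : Lang k} →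
                    (∀ a b → Dec (R a b)) → Regular L → Regular (Dominated R L)
Regular-Dominated {R = R} {L} R? (D , L⇔D) = Regular-resp spec (Regular-NAccepts automaton)
  where
  open DominationNFA R? D
  spec : ∀ u → NAccepts automaton u ⇔ Dominated R L u
  spec u = mk⇔ forward backward
    where
    forward : NAccepts automaton u → Dominated R L u
    forward ((_ , false) , refl , acc) with to (level-spec (DFA.start D) u) acc
    ... | v , accv , len , u<v = v , from (L⇔D v) accv , len , u<v
    backward : Dominated R L u → NAccepts automaton u
    backward (v , lv , len , u<v) =
      (DFA.start D , false) , refl , from (level-spec (DFA.start D) u) (v , to (L⇔D v) lv , len , u<v)

HasSuffixIn : ∀ {k} → Lang k → Lang k
HasSuffixIn L w = ∃₂ λ x s → w ≡ x ++ s × L s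

module SuffixNFA {k : ℕ} (D : DFA k) where
  open DFA D

  -- The flag records whether the suffix has begun; before that the state stays at start.
  Initial : Fin nstates × Bool → Set
  Initial (q , false) = q ≡ start
  Initial (_ , true)  = ⊥

  Step : Fin nstates × Bool → Fin k → Fin nstates × Bool → Set
  Step (_ , false) _ (q′ , false) = q′ ≡ start
  Step (_ , false) a (q′ , true)  = q′ ≡ δ start a
  Step (_ , true)  _ (_  , false) = ⊥
  Step (q , true)  a (q′ , true)  = q′ ≡ δ q a

  automaton : NFA k
  automaton = record
    { State       = Fin nstates × Bool
    ; size        = nstates * 2
    ; enumeration = ×Bool-enumeration nstates
    ; Initial     = Initial
    ; Step        = Step
    ; Final       = λ (q , _) → final q ≡ true
    ; initial?    = λ { (q , false) → q F.≟ start ; (_ , true) → no λ () }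
    ; step?       = λ { (_ , false) _ (q′ , false) → q′ F.≟ start
                      ; (_ , false) a (q′ , true)  → q′ F.≟ δ start a
                      ; (_ , true)  _ (_  , false) → no λ ()
                      ; (q , true)  a (q′ , true)  → q′ F.≟ δ q a }
    ; final?      = λ (q , _) → final q Bool.≟ true
    }

  started-spec : ∀ q w → NAcceptsFrom automaton (q , true) w ⇔ DAcceptsFrom D q w
  started-spec q []      = ⇔.refl
  started-spec q (a ∷ w) = mk⇔
    (λ { ((_ , true) , refl , acc) → to (started-spec (δ q a) w) acc })
    (λ acc → (δ q a , true) , refl , from (started-spec (δ q a) w) acc)

  waiting-spec : ∀ w → NAcceptsFrom automaton (start , false) w ⇔ HasSuffixIn (Accepts D) w
  waiting-spec []      = mk⇔ (λ acc → [] , [] , refl , acc)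
                             (λ { ([] , _ , refl , acc) → acc ; (_ ∷ _ , _ , () , _) })
  waiting-spec (a ∷ w) = mk⇔ forward backward
    where
    forward : NAcceptsFrom automaton (start , false) (a ∷ w) → HasSuffixIn (Accepts D) (a ∷ w)
    forward ((_ , false) , refl , acc) with to (waiting-spec w) acc
    ... | x , s , w≡xs , accs = a ∷ x , s , cong (a ∷_) w≡xs , accs
    forward ((_ , true) , refl , acc) = [] , a ∷ w , refl , to (started-spec _ w) acc
    backward : HasSuffixIn (Accepts D) (a ∷ w) → NAcceptsFrom automaton (start , false) (a ∷ w)
    backward ([] , s , a∷w≡s , accs) =
      (δ start a , true) , refl , from (started-spec _ w) (subst (Accepts D) (sym a∷w≡s) accs)
    backward (_ ∷ x , s , a∷w≡xs , accs) =
      (start , false) , refl , from (waiting-spec w) (x , s , ∷-injectiveʳ a∷w≡xs , accs)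

Regular-HasSuffixIn : ∀ {k} {L : Lang k} → Regular L → Regular (HasSuffixIn L)
Regular-HasSuffixIn {L = L} (D , L⇔D) = Regular-resp spec (Regular-NAccepts automaton)
  where
  open SuffixNFA D
  spec : ∀ w → NAccepts automaton w ⇔ HasSuffixIn L w
  spec w = mk⇔ forward backward
    where
    forward : NAccepts automaton w → HasSuffixIn L w
    forward ((_ , false) , refl , acc) with to (waiting-spec w) acc
    ... | x , s , w≡xs , accs = x , s , w≡xs , from (L⇔D s) accs
    backward : HasSuffixIn L w → NAccepts automaton w
    backward (x , s , w≡xs , ls) =
      (DFA.start D , false) , refl , from (waiting-spec w) (x , s , w≡xs , to (L⇔D s) ls)

-- Lexicographic order and maximal words

_<lex_ : ∀ {k} → List (Fin k) → List (Fin k) → Set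
_<lex_ = Lex-< _≡_ F._<_

≤lex-total : ∀ {k} {u v : List (Fin k)} → length u ≡ length v → u ≤lex v ⊎ v <lex u
≤lex-total {u = []}    {[]}    _   = inj₁ []≤
≤lex-total {u = a ∷ u} {b ∷ v} len with FP.<-cmp a b
... | tri< a<b _ _ = inj₁ (head< a<b)
... | tri> _ _ b<a = inj₂ (this b<a)
... | tri≈ _ refl _ = Sum.map head≡ (next refl) (≤lex-total (suc-injective len))

≤lex⇒≯lex : ∀ {k} {u v : List (Fin k)} → u ≤lex v → ¬ (v <lex u)
≤lex⇒≯lex []≤         (base ())
≤lex⇒≯lex (head< a<b) (this b<a)    = FP.<-asym a<b b<a
≤lex⇒≯lex (head< a<a) (next refl _) = FP.<-irrefl refl a<a
≤lex⇒≯lex (head≡ _)   (this a<a)    = FP.<-irrefl refl a<a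
≤lex⇒≯lex (head≡ u≤v) (next _ v<u)  = ≤lex⇒≯lex u≤v v<u

≤lex⇒≡⊎<lex : ∀ {k} {u v : List (Fin k)} → u ≤lex v → u ≡ v ⊎ u <lex v
≤lex⇒≡⊎<lex {v = []}    []≤ = inj₁ refl
≤lex⇒≡⊎<lex {v = _ ∷ _} []≤ = inj₂ halt
≤lex⇒≡⊎<lex (head< a<b)     = inj₂ (this a<b)
≤lex⇒≡⊎<lex (head≡ u≤v)     = Sum.map (cong (_ ∷_)) (next refl) (≤lex⇒≡⊎<lex u≤v)

Lex-<-flip : ∀ {A : Set} {R : A → A → Set} {u v : List A} →
             length u ≡ length v → Lex-< _≡_ R u v → Lex-< _≡_ (flip R) v u
Lex-<-flip ()  halt
Lex-<-flip _   (this aRb)     = this aRb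
Lex-<-flip len (next refl u<v) = next refl (Lex-<-flip (suc-injective len) u<v)

Lex-<-map-toℕ : ∀ {k} {u v : List (Fin k)} → u <lex v → Lex-< _≡_ _<_ (map toℕ u) (map toℕ v)
Lex-<-map-toℕ halt          = halt
Lex-<-map-toℕ (this a<b)    = this a<b
Lex-<-map-toℕ (next refl p) = next refl (Lex-<-map-toℕ p)

Max⇔¬Dominated : ∀ {k} (L : Lang k) u → Max L u ⇔ (L ∩ ∁ (Dominated F._<_ L)) u
Max⇔¬Dominated L u = mk⇔
  (λ (lu , maximal) → lu , λ (v , lv , len , u<v) → ≤lex⇒≯lex (maximal v lv len) u<v)
  (λ (lu , ¬dominated) → lu , λ v lv len →
     [ id , (λ u<v → contradiction (v , lv , len , u<v) ¬dominated) ] (≤lex-total len))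

Regular-Max : ∀ {k} {L : Lang k} → Regular L → Regular (Max L)
Regular-Max {L = L} regular = Regular-resp (λ u → ⇔.sym (Max⇔¬Dominated L u))
  (Regular-∩ regular (Regular-∁ (Regular-Dominated FP._<?_ regular)))

-- Numeration languages

[m*n+o]/n≡m : ∀ m {n o} .{{_ : NonZero n}} → o < n → (m * n + o) / n ≡ m
[m*n+o]/n≡m m {n} {o} o<n = begin
  (m * n + o) / n   ≡⟨ +-distrib-/-∣ˡ o (n∣m*n m) ⟩
  m * n / n + o / n ≡⟨ cong₂ _+_ (m*n/n≡m m n) (m<n⇒m/n≡0 o<n) ⟩
  m + 0             ≡⟨ +-identityʳ m ⟩
  m                 ∎
  where open ≡-Reasoning

[m*n+o]%n≡o : ∀ m {n o} .{{_ : NonZero n}} → o < n → (m * n + o) % n ≡ o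
[m*n+o]%n≡o m {n} {o} o<n = begin
  (m * n + o) % n ≡⟨ cong (_% n) (+-comm (m * n) o) ⟩
  (o + m * n) % n ≡⟨ [m+kn]%n≡m%n o m n ⟩
  o % n           ≡⟨ m<n⇒m%n≡m o<n ⟩
  o               ∎
  where open ≡-Reasoning

*<⇒<⌈/⌉ : ∀ {a b c} .{{_ : NonZero b}} → a * b < c → a < ⌈ c / b ⌉
*<⇒<⌈/⌉ {a} {b} {c} ab<c = subst (_≤ ⌈ c / b ⌉) (m*n/n≡m (suc a) b) (/-monoˡ-≤ b [1+a]b≤c+b∸1)
  where
  [1+a]b≤c+b∸1 : suc a * b ≤ c + b ∸ 1
  [1+a]b≤c+b∸1 = ∸-monoˡ-≤ 1 (subst (_≤ c + b) (cong suc (+-comm (a * b) b)) (+-monoˡ-≤ b ab<c))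

All<⇒map-toℕ : ∀ {k} {ns : List ℕ} → All (_< k) ns → ∃ λ (w : List (Fin k)) → map toℕ w ≡ ns
All<⇒map-toℕ []       = [] , refl
All<⇒map-toℕ (n<k ∷ ns<k) with All<⇒map-toℕ ns<k
... | w , ⟦w⟧≡ns = F.fromℕ< n<k ∷ w , cong₂ _∷_ (toℕ-fromℕ< n<k) ⟦w⟧≡ns

module Numeration (S : NumSys) where
  open NumSys S using (U; U0; incr)

  instance
    U-nonZero′ : ∀ {n} → NonZero (U n)
    U-nonZero′ = U-nonZero S _

  val : List ℕ → ℕ
  val []      = 0
  val (a ∷ s) = a * U (length s) + val s

  Admissible : List ℕ → Set
  Admissible []      = ⊤
  Admissible (a ∷ s) = val (a ∷ s) < U (suc (length s)) × Admissible s

  U-mono-≤ : ∀ {m n} → m ≤ n → U m ≤ U n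
  U-mono-≤ {n = zero}  z≤n = ≤-refl
  U-mono-≤ {n = suc n} m≤1+n with m≤n⇒m<n∨m≡n m≤1+n
  ... | inj₁ m<1+n = ≤-trans (U-mono-≤ (s≤s⁻¹ m<1+n)) (<⇒≤ (incr n))
  ... | inj₂ refl  = ≤-refl

  U-cancel-< : ∀ {m n} → U m < U n → m < n
  U-cancel-< Um<Un = ≰⇒> λ n≤m → <⇒≱ Um<Un (U-mono-≤ n≤m)

  pred[U]<U : ∀ n → pred (U n) < U n
  pred[U]<U n = m≤pred[n]⇒suc[m]≤n ≤-refl

  val<U : ∀ {w} → Admissible w → val w < U (length w)
  val<U {[]}    _           = >-nonZero⁻¹ (U 0)
  val<U {_ ∷ _} (bound , _) = bound

  Admissible-0∷ : ∀ {w} → Admissible w → Admissible (0 ∷ w)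
  Admissible-0∷ adm = <-≤-trans (val<U adm) (<⇒≤ (incr _)) , adm

  Admissible-0* : ∀ m {w} → Admissible w → Admissible (replicate m 0 ++ w)
  Admissible-0* zero    adm = adm
  Admissible-0* (suc m) adm = Admissible-0∷ (Admissible-0* m adm)

  Admissible-++⁻ʳ : ∀ x {s} → Admissible (x ++ s) → Admissible s
  Admissible-++⁻ʳ []      adm       = adm
  Admissible-++⁻ʳ (_ ∷ x) (_ , adm) = Admissible-++⁻ʳ x adm

  Admissible-drop1 : ∀ {w} → Admissible w → Admissible (drop 1 w)
  Admissible-drop1 {[]}    _         = tt
  Admissible-drop1 {_ ∷ _} (_ , adm) = adm

  length-greedy : ∀ n r → length (greedy S n r) ≡ n
  length-greedy zero    _ = refl
  length-greedy (suc n) _ = cong suc (length-greedy n _)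

  val-greedy : ∀ n r → r < U n → val (greedy S n r) ≡ r
  val-greedy zero    r r<U0 = sym (n<1⇒n≡0 (subst (r <_) U0 r<U0))
  val-greedy (suc n) r _    = begin
    r / U n * U (length (greedy S n (r % U n))) + val (greedy S n (r % U n))
      ≡⟨ cong₂ (λ l v → r / U n * U l + v) (length-greedy n _) (val-greedy n _ (m%n<n r (U n))) ⟩
    r / U n * U n + r % U n ≡⟨ +-comm _ (r % U n) ⟩
    r % U n + r / U n * U n ≡⟨ m≡m%n+[m/n]*n r (U n) ⟨
    r                       ∎
    where open ≡-Reasoning

  greedy-admissible : ∀ n r → r < U n → Admissible (greedy S n r)
  greedy-admissible zero    _ _   = tt
  greedy-admissible (suc n) r r<U =
    subst₂ _<_ (sym (val-greedy (suc n) r r<U)) (cong (U ∘ suc) (sym (length-greedy n _))) r<U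
    , greedy-admissible n _ (m%n<n r (U n))

  greedy-val : ∀ {w} → Admissible w → greedy S (length w) (val w) ≡ w
  greedy-val {[]}    _         = refl
  greedy-val {a ∷ s} (_ , adm) = cong₂ _∷_
    ([m*n+o]/n≡m a (val<U adm))
    (trans (cong (greedy S (length s)) ([m*n+o]%n≡o a (val<U adm))) (greedy-val adm))

  Rep⇒Admissible : ∀ {x w} → Rep S x w → Admissible w
  Rep⇒Admissible (ℓ , x<U , _ , refl) = greedy-admissible ℓ _ x<U

  Rep-0 : Rep S 0 []
  Rep-0 = 0 , >-nonZero⁻¹ (U 0) , (λ _ _ → z≤n) , refl

  Rep-val : ∀ {a s} → Admissible (suc a ∷ s) → Rep S (val (suc a ∷ s)) (suc a ∷ s)
  Rep-val {a} {s} adm@(bound , _) = suc (length s) , bound , minimal , sym (greedy-val adm)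
    where
    U≤val : U (length s) ≤ val (suc a ∷ s)
    U≤val = ≤-trans (m≤m+n (U (length s)) (a * U (length s))) (m≤m+n _ (val s))
    minimal : ∀ m → val (suc a ∷ s) < U m → suc (length s) ≤ m
    minimal m val<Um = U-cancel-< (≤-<-trans U≤val val<Um)

  Admissible⇒0*Rep : ∀ w → Admissible w →
                     ∃ λ m → ∃ λ x → ∃ λ v → Rep S x v × w ≡ replicate m 0 ++ v
  Admissible⇒0*Rep []          _         = 0 , 0 , [] , Rep-0 , refl
  Admissible⇒0*Rep (zero ∷ s)  (_ , adm) with Admissible⇒0*Rep s adm
  ... | m , x , v , rep , s≡0*v = suc m , x , v , rep , cong (0 ∷_) s≡0*v
  Admissible⇒0*Rep (suc a ∷ s) adm       = 0 , _ , _ , Rep-val adm , refl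

  val-∷-< : ∀ {a b s t} → a < b → length s ≡ length t → val s < U (length s) →
            val (a ∷ s) < val (b ∷ t)
  val-∷-< {a} {b} {s} {t} a<b len vs<U = begin-strict
    a * U (length s) + val s         <⟨ +-monoʳ-< (a * U (length s)) vs<U ⟩
    a * U (length s) + U (length s)  ≡⟨ +-comm _ (U (length s)) ⟩
    suc a * U (length s)             ≤⟨ *-monoˡ-≤ (U (length s)) a<b ⟩
    b * U (length s)                 ≡⟨ cong (λ n → b * U n) len ⟩
    b * U (length t)                 ≤⟨ m≤m+n _ (val t) ⟩
    b * U (length t) + val t         ∎
    where open ≤-Reasoning

  <lex⇒val< : ∀ {u v} → Lex-< _≡_ _<_ u v → length u ≡ length v → Admissible (drop 1 u) →
              val u < val v
  <lex⇒val< {_ ∷ s} {_ ∷ t} (this a<b) len adm = val-∷-< {s = s} {t} a<b (suc-injective len) (val<U adm)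
  <lex⇒val< {a ∷ s} {_ ∷ t} (next refl s<t) len adm =
    subst (λ n → a * U n + val s < a * U (length t) + val t) (sym (suc-injective len))
      (+-monoʳ-< (a * U (length t)) (<lex⇒val< s<t (suc-injective len) (Admissible-drop1 adm)))

  ⟦_⟧ : ∀ {k} → List (Fin k) → List ℕ
  ⟦_⟧ = map toℕ

  length-⟦⟧ : ∀ {k} (u v : List (Fin k)) → length u ≡ length v → length ⟦ u ⟧ ≡ length ⟦ v ⟧
  length-⟦⟧ u v len = trans (length-map toℕ u) (trans len (sym (length-map toℕ v)))

  LU⇔Admissible : ∀ {k} w → LU S k w ⇔ Admissible ⟦ w ⟧
  LU⇔Admissible w = mk⇔
    (λ (m , _ , _ , rep , w≡0*v) → subst Admissible (sym w≡0*v) (Admissible-0* m (Rep⇒Admissible rep)))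
    (Admissible⇒0*Rep ⟦ w ⟧)

  ≤lex⇒val≤ : ∀ {k} {u v : List (Fin k)} → u ≤lex v → length u ≡ length v →
              Admissible (drop 1 ⟦ u ⟧) → val ⟦ u ⟧ ≤ val ⟦ v ⟧
  ≤lex⇒val≤ {u = u} {v} u≤v len adm with ≤lex⇒≡⊎<lex u≤v
  ... | inj₁ refl = ≤-refl
  ... | inj₂ u<v  = <⇒≤ (<lex⇒val< (Lex-<-map-toℕ u<v) (length-⟦⟧ u v len) adm)

  greatest⇒Max-LU : ∀ {k} (m : List (Fin k)) → Admissible ⟦ m ⟧ →
                    val ⟦ m ⟧ ≡ pred (U (length ⟦ m ⟧)) → Max (LU S k) m
  greatest⇒Max-LU m adm val≡pred = from (LU⇔Admissible m) adm , maximal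
    where
    maximal : ∀ v → LU S _ v → length v ≡ length m → v ≤lex m
    maximal v v∈LU len with ≤lex-total len
    ... | inj₁ v≤m = v≤m
    ... | inj₂ m<v = contradiction val⟦v⟧≤val⟦m⟧ (<⇒≱ val⟦m⟧<val⟦v⟧)
      where
      val⟦m⟧<val⟦v⟧ : val ⟦ m ⟧ < val ⟦ v ⟧
      val⟦m⟧<val⟦v⟧ =
        <lex⇒val< (Lex-<-map-toℕ m<v) (length-⟦⟧ m v (sym len)) (Admissible-drop1 adm)
      val⟦v⟧<U : val ⟦ v ⟧ < U (length ⟦ m ⟧)
      val⟦v⟧<U = subst (λ n → val ⟦ v ⟧ < U n) (length-⟦⟧ v m len)
                       (val<U (to (LU⇔Admissible v) v∈LU))
      val⟦v⟧≤val⟦m⟧ : val ⟦ v ⟧ ≤ val ⟦ m ⟧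
      val⟦v⟧≤val⟦m⟧ = subst (val ⟦ v ⟧ ≤_) (sym val≡pred) (<⇒≤pred val⟦v⟧<U)

  Admissible⇒digits< : ∀ {k} → (∀ n → ⌈ U (suc n) / U n ⌉ ≤ k) →
                       ∀ {w} → Admissible w → All (_< k) w
  Admissible⇒digits< digits≤ {[]}    _             = []
  Admissible⇒digits< digits≤ {a ∷ s} (bound , adm) =
    <-≤-trans (*<⇒<⌈/⌉ (≤-<-trans (m≤m+n (a * U (length s)) (val s)) bound)) (digits≤ (length s))
    ∷ Admissible⇒digits< digits≤ adm

  module BoundedDigits {k : ℕ} (digits≤ : ∀ n → ⌈ U (suc n) / U n ⌉ ≤ k) where

    Max-LU-exists : ∀ n → ∃ λ m → Max (LU S k) m × length m ≡ n
    Max-LU-exists n with All<⇒map-toℕ (Admissible⇒digits< digits≤ (greedy-admissible n _ (pred[U]<U n)))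
    ... | m , ⟦m⟧≡greedy =
      m , greatest⇒Max-LU m adm val≡pred , trans (sym (length-map toℕ m)) length⟦m⟧≡n
      where
      adm : Admissible ⟦ m ⟧
      adm = subst Admissible (sym ⟦m⟧≡greedy) (greedy-admissible n _ (pred[U]<U n))
      length⟦m⟧≡n : length ⟦ m ⟧ ≡ n
      length⟦m⟧≡n = trans (cong length ⟦m⟧≡greedy) (length-greedy n _)
      val≡pred : val ⟦ m ⟧ ≡ pred (U (length ⟦ m ⟧))
      val≡pred = begin
        val ⟦ m ⟧                       ≡⟨ cong val ⟦m⟧≡greedy ⟩
        val (greedy S n (pred (U n)))   ≡⟨ val-greedy n _ (pred[U]<U n) ⟩
        pred (U n)                      ≡⟨ cong (pred ∘ U) length⟦m⟧≡n ⟨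
        pred (U (length ⟦ m ⟧))         ∎
        where open ≡-Reasoning

    ExceedsMax : Lang k
    ExceedsMax = Dominated F._>_ (Max (LU S k))

    Admissible⇒¬HasSuffixIn-ExceedsMax : ∀ w → Admissible ⟦ w ⟧ → ¬ HasSuffixIn ExceedsMax w
    Admissible⇒¬HasSuffixIn-ExceedsMax w adm (x , s , refl , m , (_ , maximal) , len , s>m) =
      ≤lex⇒≯lex (maximal s (from (LU⇔Admissible s) adm-s) (sym len)) (Lex-<-flip (sym len) s>m)
      where
      adm-s : Admissible ⟦ s ⟧
      adm-s = Admissible-++⁻ʳ ⟦ x ⟧ (subst Admissible (map-++ toℕ x s) adm)

    ¬HasSuffixIn-ExceedsMax⇒Admissible : ∀ w → ¬ HasSuffixIn ExceedsMax w → Admissible ⟦ w ⟧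
    ¬HasSuffixIn-ExceedsMax⇒Admissible []      _    = tt
    ¬HasSuffixIn-ExceedsMax⇒Admissible (a ∷ s) ¬bad with Max-LU-exists (suc (length s))
    ... | m , max@(m∈LU , _) , len with ≤lex-total (sym len)
    ...   | inj₂ m<as = contradiction ([] , a ∷ s , refl , m , max , len , Lex-<-flip len m<as) ¬bad
    ...   | inj₁ as≤m = bound , adm-s
      where
      adm-s : Admissible ⟦ s ⟧
      adm-s = ¬HasSuffixIn-ExceedsMax⇒Admissible s
        λ (x , t , s≡xt , e) → ¬bad (a ∷ x , t , cong (a ∷_) s≡xt , e)
      bound : val ⟦ a ∷ s ⟧ < U (suc (length ⟦ s ⟧))
      bound = ≤-<-trans (≤lex⇒val≤ as≤m (sym len) adm-s)
        (subst (λ n → val ⟦ m ⟧ < U n) (length-⟦⟧ m (a ∷ s) len)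
               (val<U (to (LU⇔Admissible m) m∈LU)))

    LU⇔¬HasSuffixIn-ExceedsMax : ∀ w → LU S k w ⇔ ∁ (HasSuffixIn ExceedsMax) w
    LU⇔¬HasSuffixIn-ExceedsMax w = ⇔.trans (LU⇔Admissible w)
      (mk⇔ (Admissible⇒¬HasSuffixIn-ExceedsMax w) (¬HasSuffixIn-ExceedsMax⇒Admissible w))

Regular-LU : ∀ (S : NumSys) (k : ℕ) → IsAlphSize S k → Regular (Max (LU S k)) → Regular (LU S k)
Regular-LU S k (digits≤ , _) regular =
  Regular-resp (λ w → ⇔.sym (LU⇔¬HasSuffixIn-ExceedsMax w))
    (Regular-∁ (Regular-HasSuffixIn (Regular-Dominated (flip FP._<?_) regular)))
  where open Numeration.BoundedDigits S digits≤

proposition4p3 : (∀ (k : ℕ) (L : Lang k) → Regular L → Regular (Max L))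
                 × (∀ (S : NumSys) (k : ℕ) → IsAlphSize S k
                      → Regular (Max (LU S k)) → Regular (LU S k))
proposition4p3 = (λ _ _ → Regular-Max) , Regular-LU
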